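{- Let $n$ be a positive integer and $\sigma(i,j,k)$ any block transposition on $[n]$. Then $\bar f(\sigma(i,j,k))=\sigma(i-1,j-1,k-1)$ if $i>0$, and $\bar f(\sigma(0,j,k))=\sigma(j-1,k-1,n)$.
   Context: $\mathrm{Sym}_n$ is the symmetric group on $[n]$, permutations in one-line notation, $(\pi\circ\rho)(t)=\pi(\rho(t))$. For integers $0\le i<j<k\le n$, the block transposition $\sigma(i,j,k)$ is $[1\cdots i\ \ j+1\cdots k\ \ i+1\cdots j\ \ k+1\cdots n]$. For $\pi\in\mathrm{Sym}_n$ let $[0\,\pi]$ be the permutation of $\{0,\dots,n\}$ fixing $0$ and agreeing with $\pi$ on $[n]$, and $\alpha:x\mapsto x+1\pmod{n+1}$. The map $\bar f:\mathrm{Sym}_n\to\mathrm{Sym}_n$ is defined by $[0\,\bar f(\pi)]=\alpha^{n}\circ[0\,\pi]\circ\alpha^{s}$ with $s=\pi^{ -1}(1)$; equivalently $\bar f(\pi)=(f(\pi^{ -1}))^{ -1}$ where $[0\,f(\pi)]=\alpha^{n+1-\pi(1)}\circ[0\,\pi]\circ\alpha$. -}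

module Defs where

open import Data.Nat using (ℕ; zero; suc; _+_; _∸_; _≤ᵇ_; _≡ᵇ_; _%_)
open import Data.Bool using (if_then_else_)

-- A permutation of [n] in one-line notation is represented as a function
-- ℕ → ℕ, of which only the values at positions 1..n are meaningful.

-- block transposition σ(i,j,k) = [1..i  j+1..k  i+1..j  k+1..n]
σ : ℕ → ℕ → ℕ → (ℕ → ℕ)
σ i j k t =
  if t ≤ᵇ i then t
  else if t ≤ᵇ i + (k ∸ j) then (t ∸ i) + j
  else if t ≤ᵇ k then t ∸ (k ∸ j)
  else t

ext0 : (ℕ → ℕ) → (ℕ → ℕ)
ext0 π zero = zero
ext0 π (suc t) = π (suc t)

αpow : (n m : ℕ) → ℕ → ℕ
αpow n m x = (x + m) % suc n

-- π⁻¹(1): the (largest, hence for a permutation the unique) position t ∈ [1..m]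
-- with π t = 1 (0 if none)
posOfOne : (ℕ → ℕ) → ℕ → ℕ
posOfOne π zero = zero
posOfOne π (suc m) = if π (suc m) ≡ᵇ 1 then suc m else posOfOne π m

fbar : ℕ → (ℕ → ℕ) → (ℕ → ℕ)
fbar n π x = αpow n n (ext0 π (αpow n (posOfOne π n) x))

-- With s = π⁻¹(1), unfolding the rotations gives  f̄(π)(x) = π(x + s) − 1, positions and
-- values read modulo n + 1 (so that position 0 is sent to n).  If i > 0 then σ(i,j,k) fixes 1,
-- s = 1, and the formula just shifts σ(i,j,k) down by one, which is σ(i−1,j−1,k−1).  If i = 0
-- then 1 sits at s = k − j + 1, the first position of the moved block i+1..j; rotating by s
-- carries the two blocks of σ(0,j,k) to the blocks j..k−1 and k..n of σ(j−1,k−1,n).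
module Submission where

open import Defs
open import Data.Nat using (ℕ; suc; _≤_; _<_; _∸_)
open import Data.Product using (_×_)
open import Relation.Binary.PropositionalEquality using (_≡_)

open import Data.Bool using (true; false)
open import Data.Bool.Properties using (T-≡)
open import Data.List using (_∷_; [])
open import Data.Nat
  using (zero; _+_; _*_; _≤ᵇ_; _≡ᵇ_; _%_; z≤n; s≤s; z<s; s<s⁻¹; _≤?_; _<?_)
open import Data.Nat.DivMod using (m≤n⇒m%n≡m; [m+kn]%n≡m%n; m%n<n)
open import Data.Nat.Properties
open import Data.Nat.Tactic.RingSolver using (solve)
open import Data.Product using (_,_)
open import Data.Sum using (_⊎_; inj₁; inj₂)
open import Function.Bundles using (Equivalence)
open import Relation.Nullary using (yes; no; contradiction)
open import Relation.Binary.PropositionalEquality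
  using (refl; sym; trans; cong; subst; module ≡-Reasoning)

private
  variable
    i j k a b m n p s t u x y z : ℕ

≤ᵇ-true : m ≤ n → (m ≤ᵇ n) ≡ true
≤ᵇ-true m≤n = Equivalence.to T-≡ (≤⇒≤ᵇ m≤n)

≤ᵇ-false : n < m → (m ≤ᵇ n) ≡ false
≤ᵇ-false {n} {m} n<m with m ≤ᵇ n | ≤ᵇ⇒≤ m n
... | false | _   = refl
... | true  | m≤n = contradiction (m≤n _) (<⇒≱ n<m)

m+o≡n⇒m≤n : ∀ o → m + o ≡ n → m ≤ n
m+o≡n⇒m≤n {m} o refl = m≤m+n m o

m≡r+kd⇒m%d≡r : m ≡ y + k * suc n → y ≤ n → m % suc n ≡ y
m≡r+kd⇒m%d≡r {y = y} {k} {n} refl y≤n =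
  trans ([m+kn]%n≡m%n y k (suc n)) (m≤n⇒m%n≡m y≤n)

-- The positions of σ i (i + a) (i + a + b): σ fills the b front positions i+1..i+b with the
-- values i+a+1..i+a+b, and the a back positions i+b+1..i+a+b with the values i+1..i+a.
data Region (i a b : ℕ) : ℕ → Set where
  prefix : t ≤ i → Region i a b t
  front  : u < b → Region i a b (i + suc u)
  back   : u < a → Region i a b (i + suc u + b)
  suffix : i + a + b < t → Region i a b t

region : ∀ i a b t → Region i a b t
region i a b t with t ≤? i
... | yes t≤i = prefix t≤i
... | no t≰i with m≤n⇒∃[o]m+o≡n (≰⇒> t≰i)
... | u , refl with u <? b
...   | yes u<b = subst (Region i a b) (+-suc i u) (front u<b)
...   | no u≮b with m≤n⇒∃[o]m+o≡n (≮⇒≥ u≮b)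
...     | v , refl with v <? a
...       | yes v<a = subst (Region i a b) back-position (back v<a)
  where
  back-position : i + suc v + b ≡ suc (i + (b + v))
  back-position = solve (i ∷ b ∷ v ∷ [])
...       | no v≮a = suffix (s≤s (subst (_≤ i + (b + v)) reorder a≤b+v))
  where
  reorder : i + (b + a) ≡ i + a + b
  reorder = solve (i ∷ a ∷ b ∷ [])
  a≤b+v : i + (b + a) ≤ i + (b + v)
  a≤b+v = +-monoʳ-≤ i (+-monoʳ-≤ b (≮⇒≥ v≮a))

σ-prefix : ∀ {i j k t} → t ≤ i → σ i j k t ≡ t
σ-prefix t≤i rewrite ≤ᵇ-true t≤i = refl

σ-front : u < b → σ i (i + a) (i + a + b) (i + suc u) ≡ i + a + suc u
σ-front {u} {b} {i} {a} u<b
  rewrite ≤ᵇ-false (m<m+n i {suc u} z<s) | m+n∸m≡n (i + a) b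
        | ≤ᵇ-true (+-monoʳ-≤ i u<b) | m+n∸m≡n i (suc u)
  = +-comm (suc u) (i + a)

σ-back : u < a → σ i (i + a) (i + a + b) (i + suc u + b) ≡ i + suc u
σ-back {u} {a} {i} {b} u<a
  rewrite ≤ᵇ-false (≤-trans (m<m+n i {suc u} z<s) (m≤m+n (i + suc u) b))
        | m+n∸m≡n (i + a) b
        | ≤ᵇ-false (+-monoˡ-< b (m<m+n i {suc u} z<s))
        | ≤ᵇ-true (+-monoˡ-≤ b (+-monoʳ-≤ i u<a))
  = m+n∸n≡m (i + suc u) b

σ-suffix : i + a + b < t → σ i (i + a) (i + a + b) t ≡ t
σ-suffix {i} {a} {b} {t} k<t
  rewrite ≤ᵇ-false (≤-<-trans (≤-trans (m≤m+n i a) (m≤m+n (i + a) b)) k<t)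
        | m+n∸m≡n (i + a) b
        | ≤ᵇ-false (≤-<-trans (+-monoˡ-≤ b (m≤m+n i a)) k<t)
        | ≤ᵇ-false k<t
  = refl

σ-suc : ∀ i a b t →
        σ (suc i) (suc (i + a)) (suc (i + a + b)) (suc t) ≡ suc (σ i (i + a) (i + a + b) t)
σ-suc i a b t with region i a b t
... | prefix t≤i =
  trans (σ-prefix {k = suc (i + a + b)} (s≤s t≤i)) (cong suc (sym (σ-prefix t≤i)))
... | front u<b =
  trans (σ-front {i = suc i} {a} u<b) (cong suc (sym (σ-front {i = i} {a} u<b)))
... | back u<a =
  trans (σ-back {i = suc i} {b} u<a) (cong suc (sym (σ-back {i = i} {b} u<a)))
... | suffix k<t =
  trans (σ-suffix {suc i} {a} {b} (s≤s k<t)) (cong suc (sym (σ-suffix {i} {a} {b} k<t)))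

σ-≤ : ∀ i a b → i + a + b ≤ m → t ≤ m → σ i (i + a) (i + a + b) t ≤ m
σ-≤ {m} {t} i a b k≤m t≤m with region i a b t
... | prefix t≤i = ≤-trans (≤-reflexive (σ-prefix t≤i)) t≤m
... | front {u} u<b =
  ≤-trans (≤-reflexive (σ-front {i = i} {a} u<b)) (≤-trans (+-monoʳ-≤ (i + a) u<b) k≤m)
... | back {u} u<a =
  ≤-trans (≤-reflexive (σ-back {i = i} {b} u<a)) (≤-trans (m≤m+n (i + suc u) b) t≤m)
... | suffix k<t = ≤-trans (≤-reflexive (σ-suffix {i} {a} {b} k<t)) t≤m

σ-preimage-1 : σ i (i + a) (i + a + b) t ≡ 1 → t ≡ 1 ⊎ (i ≡ 0 × t ≡ suc b)
σ-preimage-1 {i} {a} {b} {t} σt≡1 with region i a b t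
... | prefix t≤i = inj₁ (trans (sym (σ-prefix t≤i)) σt≡1)
... | front {u} u<b = inj₁ (≤-antisym t≤1 (≤-trans z<s (m≤n+m (suc u) i)))
  where
  value≡1 : i + a + suc u ≡ 1
  value≡1 = trans (sym (σ-front {i = i} {a} u<b)) σt≡1
  t≤1 : i + suc u ≤ 1
  t≤1 = ≤-trans (+-monoˡ-≤ (suc u) (m≤m+n i a)) (≤-reflexive value≡1)
... | back {u} u<a = inj₂ (i≡0 , cong (_+ b) value≡1)
  where
  value≡1 : i + suc u ≡ 1
  value≡1 = trans (sym (σ-back {i = i} {b} u<a)) σt≡1
  i≡0 : i ≡ 0
  i≡0 = m+n≡0⇒m≡0 i (suc-injective (trans (sym (+-suc i u)) value≡1))
... | suffix k<t = inj₁ (trans (sym (σ-suffix {i} {a} {b} k<t)) σt≡1)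

posOfOne-last : ∀ π → π p ≡ 1 → 1 ≤ p → p ≤ m → (∀ {t} → π t ≡ 1 → t ≤ p) →
                posOfOne π m ≡ p
posOfOne-last {m = zero} _ _ 1≤p p≤0 _ = contradiction (≤-trans 1≤p p≤0) λ ()
posOfOne-last {p} {suc m} π πp≡1 1≤p p≤1+m last with m≤n⇒m<n∨m≡n p≤1+m
... | inj₂ refl rewrite πp≡1 = refl
... | inj₁ (s≤s p≤m) with π (suc m) ≡ᵇ 1 | ≡ᵇ⇒≡ (π (suc m)) 1
...   | true  | π[1+m]≡1 = contradiction (last (π[1+m]≡1 _)) (<⇒≱ (s≤s p≤m))
...   | false | _        = posOfOne-last π πp≡1 1≤p p≤m last

fbar-rotated-pos : ∀ π x → (∀ {t} → t ≤ n → π t ≤ n) → posOfOne π n ≡ s →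
                   (x + s) % suc n ≡ y → 0 < y → π y ≡ suc z → fbar n π x ≡ z
fbar-rotated-pos {n} {s} {suc y} {z} π x maps refl x+s≡y _ πy≡1+z = begin
  fbar n π x               ≡⟨ cong (λ w → (ext0 π w + n) % suc n) x+s≡y ⟩
  (π (suc y) + n) % suc n  ≡⟨ cong (λ w → (w + n) % suc n) πy≡1+z ⟩
  (suc z + n) % suc n      ≡⟨ m≡r+kd⇒m%d≡r {k = 1} one-turn (<⇒≤ 1+z≤n) ⟩
  z                        ∎
  where
  open ≡-Reasoning
  one-turn : suc z + n ≡ z + 1 * suc n
  one-turn = solve (z ∷ n ∷ [])
  1+y≤n : suc y ≤ n
  1+y≤n = ≤-pred (subst (_< suc n) x+s≡y (m%n<n (x + posOfOne π n) (suc n)))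
  1+z≤n : suc z ≤ n
  1+z≤n = subst (_≤ n) πy≡1+z (maps 1+y≤n)

fbar-rotated-zero : ∀ π x → posOfOne π n ≡ s → (x + s) % suc n ≡ 0 → fbar n π x ≡ n
fbar-rotated-zero {n} π x refl x+s≡0 =
  trans (cong (λ w → (ext0 π w + n) % suc n) x+s≡0) (m≤n⇒m%n≡m ≤-refl)

posOfOne-σ-shift : ∀ i a b → suc (i + a + b) ≤ n →
                   posOfOne (σ (suc i) (suc (i + a)) (suc (i + a + b))) n ≡ 1
posOfOne-σ-shift i a b k≤n =
  posOfOne-last _ fixes-1 ≤-refl (≤-trans (s≤s z≤n) k≤n) only-1
  where
  fixes-1 : σ (suc i) (suc (i + a)) (suc (i + a + b)) 1 ≡ 1
  fixes-1 = σ-prefix {suc i} {suc (i + a)} {suc (i + a + b)} (s≤s z≤n)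
  only-1 : σ (suc i) (suc (i + a)) (suc (i + a + b)) t ≡ 1 → t ≤ 1
  only-1 πt≡1 with σ-preimage-1 {suc i} {a} {b} πt≡1
  ... | inj₁ t≡1 = ≤-reflexive t≡1

fbar-σ-shift : suc (i + a + b) ≤ n → x ≤ n →
               fbar n (σ (suc i) (suc (i + a)) (suc (i + a + b))) x ≡ σ i (i + a) (i + a + b) x
fbar-σ-shift {i} {a} {b} {n} {x} k≤n x≤n with m≤n⇒m<n∨m≡n x≤n
... | inj₁ x<n =
  fbar-rotated-pos _ x (σ-≤ (suc i) a b k≤n) (posOfOne-σ-shift i a b k≤n)
                   (m≡r+kd⇒m%d≡r {k = 0} no-turn x<n) z<s (σ-suc i a b x)
  where
  no-turn : x + 1 ≡ suc x + 0 * suc n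
  no-turn = solve (x ∷ [])
... | inj₂ refl =
  trans (fbar-rotated-zero _ x (posOfOne-σ-shift i a b k≤n) (m≡r+kd⇒m%d≡r {k = 1} one-turn z≤n))
        (sym (σ-suffix {i} {a} {b} k≤n))
  where
  one-turn : x + 1 ≡ 0 + 1 * suc x
  one-turn = solve (x ∷ [])

posOfOne-σ-zero : ∀ p b → suc (p + b) ≤ n → posOfOne (σ 0 (suc p) (suc (p + b))) n ≡ suc b
posOfOne-σ-zero p b k≤n =
  posOfOne-last _ (σ-back {0} {suc p} {0} {b} z<s) z<s (≤-trans (s≤s (m≤n+m b p)) k≤n) at-most-1+b
  where
  at-most-1+b : σ 0 (suc p) (suc (p + b)) t ≡ 1 → t ≤ suc b
  at-most-1+b πt≡1 with σ-preimage-1 {0} {suc p} {b} πt≡1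
  ... | inj₁ t≡1          = ≤-trans (≤-reflexive t≡1) (s≤s z≤n)
  ... | inj₂ (_ , t≡1+b) = ≤-reflexive t≡1+b

fbar-σ-zero : ∀ p b d → x ≤ p + b + suc d →
              fbar (p + b + suc d) (σ 0 (suc p) (suc (p + b))) x ≡ σ p (p + b) (p + b + suc d) x
fbar-σ-zero p b d x≤N = by-region (region p b (suc d) _) x≤N
  where
  N : ℕ
  N = p + b + suc d
  τ : ℕ → ℕ
  τ = σ 0 (suc p) (suc (p + b))
  k≤N : suc (p + b) ≤ N
  k≤N = ≤-trans (s≤s (m≤m+n (p + b) d)) (≤-reflexive (sym (+-suc (p + b) d)))
  maps : t ≤ N → τ t ≤ N
  maps = σ-≤ 0 (suc p) b k≤N
  start : posOfOne τ N ≡ suc b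
  start = posOfOne-σ-zero p b k≤N
  by-region : ∀ {x} → Region p b (suc d) x → x ≤ N → fbar N τ x ≡ σ p (p + b) N x
  by-region {x} (prefix x≤p) _ =
    trans (fbar-rotated-pos τ x maps start (m≡r+kd⇒m%d≡r {k = 0} no-turn y≤N) z<s
                            (σ-back {x} {suc p} {0} {b} (s≤s x≤p)))
          (sym (σ-prefix x≤p))
    where
    no-turn : x + suc b ≡ suc x + b + 0 * suc N
    no-turn = solve (x ∷ b ∷ p ∷ d ∷ [])
    rearrange : suc p + b + d ≡ p + b + suc d
    rearrange = solve (p ∷ b ∷ d ∷ [])
    y≤N : suc x + b ≤ N
    y≤N = ≤-trans (+-monoˡ-≤ b (s≤s x≤p)) (m+o≡n⇒m≤n d rearrange)
  by-region (front {u} u<1+d) _ with m≤n⇒m<n∨m≡n (≤-pred u<1+d)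
  ... | inj₁ u<d =
    trans (fbar-rotated-pos τ (p + suc u) maps start (m≡r+kd⇒m%d≡r {k = 0} no-turn y≤N) z<s τy≡1+z)
          (sym (σ-front {u} {suc d} {p} {b} u<1+d))
    where
    no-turn : p + suc u + suc b ≡ suc (p + suc u + b) + 0 * suc N
    no-turn = solve (p ∷ u ∷ b ∷ d ∷ [])
    rearrange : p + suc u + b ≡ p + b + suc u
    rearrange = solve (p ∷ u ∷ b ∷ [])
    y≤N : suc (p + suc u + b) ≤ N
    y≤N = ≤-trans (≤-reflexive (trans (cong suc rearrange) (sym (+-suc (p + b) (suc u)))))
                  (+-monoʳ-≤ (p + b) (s≤s u<d))
    τy≡1+z : τ (suc (p + suc u + b)) ≡ suc (p + b + suc u)
    τy≡1+z = trans (σ-suffix {0} {suc p} {b} (s≤s (+-monoˡ-≤ b (m<m+n p z<s))))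
                   (cong suc rearrange)
  ... | inj₂ refl =
    trans (fbar-rotated-zero τ (p + suc d) start (m≡r+kd⇒m%d≡r {k = 1} one-turn z≤n))
          (sym (σ-front {d} {suc d} {p} {b} u<1+d))
    where
    one-turn : p + suc d + suc b ≡ 0 + 1 * suc (p + b + suc d)
    one-turn = solve (p ∷ b ∷ d ∷ [])
  by-region (back {u} u<b) _ =
    trans (fbar-rotated-pos τ (p + suc u + suc d) maps start (m≡r+kd⇒m%d≡r {k = 1} one-turn y≤N)
                            z<s (σ-front {u} {b} {0} {suc p} u<b))
          (sym (σ-back {u} {b} {p} {suc d} u<b))
    where
    one-turn : p + suc u + suc d + suc b ≡ suc u + 1 * suc (p + b + suc d)
    one-turn = solve (p ∷ u ∷ b ∷ d ∷ [])
    y≤N : suc u ≤ N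
    y≤N = ≤-trans u<b (≤-trans (m≤n+m b p) (m≤m+n (p + b) (suc d)))
  by-region (suffix k<x) x≤N = contradiction x≤N (<⇒≱ k<x)

data Blocks : ℕ → ℕ → ℕ → Set where
  blocks : ∀ i a b → Blocks i (i + a) (i + a + b)

blocks-of : i ≤ j → j ≤ k → Blocks i j k
blocks-of i≤j j≤k with m≤n⇒∃[o]m+o≡n i≤j | m≤n⇒∃[o]m+o≡n j≤k
... | a , refl | b , refl = blocks _ a b

lemma3 : (n i j k : ℕ) → 1 ≤ n → i < j → j < k → k ≤ n →
    ((0 < i → (x : ℕ) → 1 ≤ x → x ≤ n →
        fbar n (σ i j k) x ≡ σ (i ∸ 1) (j ∸ 1) (k ∸ 1) x)
    × (i ≡ 0 → (x : ℕ) → 1 ≤ x → x ≤ n →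
        fbar n (σ 0 j k) x ≡ σ (j ∸ 1) (k ∸ 1) n x))
lemma3 n i       zero    k       _ ()  _   _
lemma3 n i       (suc j) zero    _ _   ()  _
lemma3 n zero    (suc j) (suc k) _ _   j<k k<n with blocks-of (<⇒≤ (s<s⁻¹ j<k)) (<⇒≤ k<n)
... | blocks _ b zero    = contradiction (≤-trans k<n (≤-reflexive (+-identityʳ _))) (n≮n _)
... | blocks _ b (suc d) = (λ ()) , λ _ x _ x≤n → fbar-σ-zero j b d x≤n
lemma3 n (suc i) (suc j) (suc k) _ i<j j<k k≤n
  with blocks-of (<⇒≤ (s<s⁻¹ i<j)) (<⇒≤ (s<s⁻¹ j<k))
... | blocks _ a b = (λ _ x _ x≤n → fbar-σ-shift k≤n x≤n) , λ ()
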